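{- Let $n\ge 1$ and let $\mathcal{A},\mathcal{B}\subset S_n$ be strong up-sets. Then \[ \frac{|\mathcal{A}\cap\mathcal{B}|}{n!}\geq \frac{|\mathcal{A}|}{n!}\cdot\frac{|\mathcal{B}|}{n!}. \] That is, the uniform probability measure on $S_n$ is positively associated for the strong order.
   Context: Elements of $S_n$ are regarded as $n$-tuples $\mathbf{a}=(a_1,\dots,a_n)$ of distinct elements of $[n]=\{1,\dots,n\}$. For $i\in[n]$, $\mathrm{pos}(\mathbf{a},i)=k$ if $a_k=i$. For $1\le i<j\le n$, the pair $\{i,j\}$ is an inversion of $\mathbf{a}$ if $\mathrm{pos}(\mathbf{a},i)>\mathrm{pos}(\mathbf{a},j)$. A family $\mathcal{A}\subset S_n$ is a strong up-set if whenever $\mathbf{a}\in\mathcal{A}$ and $\{i,j\}$ is an inversion of $\mathbf{a}$, the permutation obtained from $\mathbf{a}$ by swapping the entries $i$ and $j$ is also in $\mathcal{A}$. A probability measure $\mu$ on $S_n$ is positively associated (for the strong order) if $\mu(\mathcal{A}\cap\mathcal{B})\ge\mu(\mathcal{A})\mu(\mathcal{B})$ for all strong up-sets $\mathcal{A},\mathcal{B}$. -}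

module Defs where

open import Data.Nat using (ℕ; zero; suc)
open import Data.Fin using (Fin; _<_; _≟_)
open import Data.Fin.Properties using (all?)
open import Data.Fin.Permutation.Components using (transpose)
open import Data.Vec using (Vec; []; _∷_; lookup; map)
open import Data.List using (List; []; _∷_; concatMap; length; filter)
open import Data.List.Base using () renaming (map to mapL)
open import Data.Fin using (Fin)
open import Data.Fin.Base using () renaming (zero to fz)
open import Data.List using (allFin)
open import Data.Product using (_×_)
open import Relation.Nullary using (Dec; yes; no)
open import Relation.Nullary.Decidable using (_→-dec_; _×-dec_)
open import Relation.Unary using (Pred; Decidable)
open import Level using (0ℓ)
open import Relation.Binary.PropositionalEquality using (_≡_)

Tuple : ℕ → Set
Tuple n = Vec (Fin n) n

allVecs : (n m : ℕ) → List (Vec (Fin n) m)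
allVecs n zero    = [] ∷ []
allVecs n (suc m) = concatMap (λ x → mapL (x ∷_) (allVecs n m)) (allFin n)

allTuples : (n : ℕ) → List (Tuple n)
allTuples n = allVecs n n

IsPerm : ∀ {n} → Tuple n → Set
IsPerm a = ∀ k l → lookup a k ≡ lookup a l → k ≡ l

isPerm? : ∀ {n} → Decidable (IsPerm {n})
isPerm? a = all? (λ k → all? (λ l → (lookup a k ≟ lookup a l) →-dec (k ≟ l)))

swapEntries : ∀ {n} → Fin n → Fin n → Tuple n → Tuple n
swapEntries i j a = map (transpose i j) a

IsInversion : ∀ {n} → Tuple n → Fin n → Fin n → Set
IsInversion a i j = (i < j) × (∀ p q → lookup a p ≡ i → lookup a q ≡ j → q < p)

-- a family A ⊆ S_n is a predicate on tuples, restricted to permutations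
StrongUpSet : ∀ {n} → Pred (Tuple n) 0ℓ → Set
StrongUpSet {n} A =
  ∀ (a : Tuple n) → IsPerm a → A a →
  ∀ (i j : Fin n) → IsInversion a i j → A (swapEntries i j a)

card : ∀ {n} {A : Pred (Tuple n) 0ℓ} → Decidable A → ℕ
card {n} A? = length (filter (λ a → isPerm? a ×-dec A? a) (allTuples n))

∩? : ∀ {n} {A B : Pred (Tuple n) 0ℓ} → Decidable A → Decidable B →
     Decidable (λ a → A a × B a)
∩? A? B? a = A? a ×-dec B? a

-- Split S_(m+1) by the first entry x: deleting it and relabelling the rest monotonically identifies
-- the permutations starting with x with S_m, and turns a strong up-set A into a strong up-set A_x of S_m.
-- Lowering the first entry from i+1 to i resolves the inversion {i, i+1}, so |A_x| is nonincreasing in x,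
-- and likewise |B_x|. Chebyshev's sum inequality gives |A| |B| = Σ |A_x| Σ |B_x| ≤ (m+1) Σ |A_x| |B_x|,
-- and by induction |A_x| |B_x| ≤ m! |A_x ∩ B_x|.
module Submission where

open import Defs
open import Data.Nat using (ℕ; zero; suc; _+_; _*_; _≤_; z≤n; s≤s; _!)
open import Data.Nat.Properties using (+-*-semiring; <⇒≤; ≤-refl; ≤-reflexive; ≤-trans; +-mono-≤; +-monoʳ-≤; *-monoʳ-≤; m≤m+n; m≤n⇒∃[o]m+o≡n; *-assoc; module ≤-Reasoning)
open import Data.Nat.Solver using (module +-*-Solver)
open import Data.Fin as Fin using (Fin; punchIn; inject₁; _≟_) renaming (zero to fz; suc to fs)
open import Data.Fin.Properties using (all?; punchIn-injective; punchInᵢ≢i; suc-injective; toℕ-inject₁; punchIn-mono-≤; ≤∧≢⇒<; <⇒≢)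
open import Data.Fin.Permutation.Components using (transpose)
open import Data.Vec using (Vec; []; _∷_; lookup; map)
open import Data.Vec.Properties using (lookup-map; map-∘; map-cong)
open import Data.List using (List; []; _∷_; _++_; length; filter; concatMap; tabulate)
open import Data.List.Base using () renaming (map to mapL)
open import Data.List.Properties using (length-++; filter-++; filter-≐; filter-none)
open import Data.List.Relation.Unary.All using (universal)
open import Data.List.Relation.Binary.Sublist.Propositional using (⊆-refl)
open import Data.List.Relation.Binary.Sublist.Propositional.Properties using (filter⁺; length-mono-≤)
open import Data.Product using (_×_; _,_; proj₁)
open import Data.Bool using (true; false)
open import Data.Empty using (⊥-elim)
open import Function using (_∘_)
open import Level using (0ℓ)
open import Relation.Nullary using (Dec; yes; no; ¬_; does; ¬?)
open import Relation.Nullary.Decidable using (_→-dec_; _×-dec_)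
open import Relation.Unary using (Pred; Decidable; _⊆_; _≐_)
open import Relation.Binary.PropositionalEquality
open import Algebra.Properties.Semiring.Sum +-*-semiring using (sum; sum-cong-≗; sum-remove; ∑-distrib-+; *-distribˡ-sum; *-distribʳ-sum)

count : ∀ {X : Set} {P : Pred X 0ℓ} → Decidable P → List X → ℕ
count P? xs = length (filter P? xs)

count-mono : ∀ {X : Set} {P Q : Pred X 0ℓ} (P? : Decidable P) (Q? : Decidable Q) →
             P ⊆ Q → ∀ xs → count P? xs ≤ count Q? xs
count-mono P? Q? P⊆Q xs = length-mono-≤ (filter⁺ P? Q? (λ { refl → P⊆Q }) (⊆-refl {x = xs}))

count-≐ : ∀ {X : Set} {P Q : Pred X 0ℓ} (P? : Decidable P) (Q? : Decidable Q) →
          P ≐ Q → ∀ xs → count P? xs ≡ count Q? xs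
count-≐ P? Q? P≐Q xs = cong length (filter-≐ P? Q? P≐Q xs)

count-none : ∀ {X : Set} {P : Pred X 0ℓ} (P? : Decidable P) → (∀ x → ¬ P x) → ∀ xs → count P? xs ≡ 0
count-none P? ¬P xs = cong length (filter-none P? (universal ¬P xs))

count-map : ∀ {X Y : Set} {P : Pred Y 0ℓ} (P? : Decidable P) (f : X → Y) (xs : List X) →
            count P? (mapL f xs) ≡ count (P? ∘ f) xs
count-map P? f [] = refl
count-map P? f (x ∷ xs) with does (P? (f x))
... | true  = cong suc (count-map P? f xs)
... | false = count-map P? f xs

count-concatMap : ∀ {X A : Set} {P : Pred X 0ℓ} (P? : Decidable P) {k} (h : A → List X) (f : Fin k → A) →
                  count P? (concatMap h (tabulate f)) ≡ sum (λ i → count P? (h (f i)))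
count-concatMap P? {zero}  h f = refl
count-concatMap P? {suc k} h f = begin
  length (filter P? (h (f fz) ++ concatMap h (tabulate (f ∘ fs))))
    ≡⟨ cong length (filter-++ P? (h (f fz)) _) ⟩
  length (filter P? (h (f fz)) ++ filter P? (concatMap h (tabulate (f ∘ fs))))
    ≡⟨ length-++ (filter P? (h (f fz))) ⟩
  count P? (h (f fz)) + count P? (concatMap h (tabulate (f ∘ fs)))
    ≡⟨ cong (count P? (h (f fz)) +_) (count-concatMap P? h (f ∘ fs)) ⟩
  count P? (h (f fz)) + sum (λ i → count P? (h (f (fs i)))) ∎
  where open ≡-Reasoning

count-allVecs-suc : ∀ {n k} {P : Pred (Vec (Fin n) (suc k)) 0ℓ} (P? : Decidable P) →
                    count P? (allVecs n (suc k)) ≡ sum (λ y → count (P? ∘ (y ∷_)) (allVecs n k))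
count-allVecs-suc {n} {k} P? =
  trans (count-concatMap P? (λ y → mapL (y ∷_) (allVecs n k)) (λ y → y))
        (sum-cong-≗ (λ y → count-map P? (y ∷_) (allVecs n k)))

sum-mono-≤ : ∀ {k} {f g : Fin k → ℕ} → (∀ i → f i ≤ g i) → sum f ≤ sum g
sum-mono-≤ {zero}  f≤g = z≤n
sum-mono-≤ {suc k} f≤g = +-mono-≤ (f≤g fz) (sum-mono-≤ (f≤g ∘ fs))

sum-const : ∀ k (c : ℕ) → sum {k} (λ _ → c) ≡ k * c
sum-const zero    c = refl
sum-const (suc k) c = cong (c +_) (sum-const k c)

Nonincreasing : ∀ {k} → (Fin (suc k) → ℕ) → Set
Nonincreasing {k} f = ∀ (i : Fin k) → f (fs i) ≤ f (inject₁ i)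

nonincreasing-≤-head : ∀ {k} {f : Fin (suc k) → ℕ} → Nonincreasing f → ∀ i → f i ≤ f fz
nonincreasing-≤-head         dec fz     = ≤-refl
nonincreasing-≤-head {suc k} dec (fs i) = ≤-trans (nonincreasing-≤-head (dec ∘ fs) i) (dec fz)

rearrangement-≤ : ∀ {a b y z} → y ≤ a → z ≤ b → a * z + y * b ≤ a * b + y * z
rearrangement-≤ {y = y} {z = z} y≤a z≤b with m≤n⇒∃[o]m+o≡n y≤a | m≤n⇒∃[o]m+o≡n z≤b
... | d , refl | e , refl = ≤-trans (m≤m+n _ (d * e)) (≤-reflexive (expand y d z e))
  where
  open +-*-Solver
  expand : ∀ y d z e → (y + d) * z + y * (z + e) + d * e ≡ (y + d) * (z + e) + y * z
  expand = solve 4 (λ y d z e → (y :+ d) :* z :+ y :* (z :+ e) :+ d :* e := (y :+ d) :* (z :+ e) :+ y :* z) refl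

chebyshev : ∀ k (f g : Fin (suc k) → ℕ) → Nonincreasing f → Nonincreasing g →
            sum f * sum g ≤ suc k * sum (λ i → f i * g i)
chebyshev zero f g _ _ = ≤-reflexive (single (f fz) (g fz))
  where
  open +-*-Solver
  single : ∀ a b → (a + 0) * (b + 0) ≡ 1 * (a * b + 0)
  single = solve 2 (λ a b → (a :+ con 0) :* (b :+ con 0) := con 1 :* (a :* b :+ con 0)) refl
chebyshev (suc k) f g f-dec g-dec = begin
  (a + F) * (b + G)                         ≡⟨ expand a b F G ⟩
  a * b + (a * G + F * b) + F * G           ≤⟨ +-mono-≤ (+-monoʳ-≤ (a * b) cross) tail ⟩
  a * b + (suc k * (a * b) + S) + suc k * S ≡⟨ collect k (a * b) S ⟩
  suc (suc k) * (a * b + S)                 ∎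
  where
  open ≤-Reasoning
  open +-*-Solver
  a = f fz
  b = g fz
  F = sum (f ∘ fs)
  G = sum (g ∘ fs)
  S = sum (λ i → f (fs i) * g (fs i))
  tail : F * G ≤ suc k * S
  tail = chebyshev k (f ∘ fs) (g ∘ fs) (f-dec ∘ fs) (g-dec ∘ fs)
  cross : a * G + F * b ≤ suc k * (a * b) + S
  cross = begin
    a * G + F * b
      ≡⟨ cong₂ _+_ (*-distribˡ-sum a (g ∘ fs)) (*-distribʳ-sum b (f ∘ fs)) ⟩
    sum (λ i → a * g (fs i)) + sum (λ i → f (fs i) * b)
      ≡⟨ ∑-distrib-+ (λ i → a * g (fs i)) (λ i → f (fs i) * b) ⟨
    sum (λ i → a * g (fs i) + f (fs i) * b)
      ≤⟨ sum-mono-≤ (λ i → rearrangement-≤ (nonincreasing-≤-head {f = f} f-dec (fs i))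
                                           (nonincreasing-≤-head {f = g} g-dec (fs i))) ⟩
    sum (λ i → a * b + f (fs i) * g (fs i))
      ≡⟨ ∑-distrib-+ (λ _ → a * b) (λ i → f (fs i) * g (fs i)) ⟩
    sum {suc k} (λ _ → a * b) + S
      ≡⟨ cong (_+ S) (sum-const (suc k) (a * b)) ⟩
    suc k * (a * b) + S ∎
  expand : ∀ a b F G → (a + F) * (b + G) ≡ a * b + (a * G + F * b) + F * G
  expand = solve 4 (λ a b F G → (a :+ F) :* (b :+ G) := a :* b :+ (a :* G :+ F :* b) :+ F :* G) refl
  collect : ∀ k ab S → ab + (suc k * ab + S) + suc k * S ≡ suc (suc k) * (ab + S)
  collect = solve 3 (λ k ab S → ab :+ ((con 1 :+ k) :* ab :+ S) :+ (con 1 :+ k) :* S := (con 2 :+ k) :* (ab :+ S)) refl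

Distinct : ∀ {n m} → Vec (Fin n) m → Set
Distinct a = ∀ k l → lookup a k ≡ lookup a l → k ≡ l

distinct? : ∀ {n m} → Decidable (Distinct {n} {m})
distinct? a = all? (λ k → all? (λ l → (lookup a k ≟ lookup a l) →-dec (k ≟ l)))

Avoids : ∀ {n m} → Fin n → Vec (Fin n) m → Set
Avoids x r = ∀ p → lookup r p ≢ x

avoids? : ∀ {n m} (x : Fin n) → Decidable (Avoids {n} {m} x)
avoids? x r = all? (λ p → ¬? (lookup r p ≟ x))

distinct-∷⁻ : ∀ {n m} {x : Fin n} {r : Vec (Fin n) m} → Distinct (x ∷ r) → Avoids x r × Distinct r
distinct-∷⁻ d = (λ p e → fs≢fz (d (fs p) fz e)) , (λ k l e → suc-injective (d (fs k) (fs l) e))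
  where
  fs≢fz : ∀ {m} {p : Fin m} → fs p ≢ fz
  fs≢fz ()

distinct-∷⁺ : ∀ {n m} {x : Fin n} {r : Vec (Fin n) m} → Avoids x r × Distinct r → Distinct (x ∷ r)
distinct-∷⁺ (x∉r , d) fz     fz     e = refl
distinct-∷⁺ (x∉r , d) fz     (fs l) e = ⊥-elim (x∉r l (sym e))
distinct-∷⁺ (x∉r , d) (fs k) fz     e = ⊥-elim (x∉r k e)
distinct-∷⁺ (x∉r , d) (fs k) (fs l) e = cong fs (d k l e)

lookup-punchIn : ∀ {n m} (x : Fin (suc n)) (σ : Vec (Fin n) m) p → lookup (map (punchIn x) σ) p ≡ punchIn x (lookup σ p)
lookup-punchIn x σ p = lookup-map p (punchIn x) σ

distinct-punchIn⁻ : ∀ {n m} (x : Fin (suc n)) (σ : Vec (Fin n) m) → Distinct (map (punchIn x) σ) → Distinct σ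
distinct-punchIn⁻ x σ d k l e =
  d k l (trans (lookup-punchIn x σ k) (trans (cong (punchIn x) e) (sym (lookup-punchIn x σ l))))

distinct-punchIn⁺ : ∀ {n m} (x : Fin (suc n)) (σ : Vec (Fin n) m) → Distinct σ → Distinct (map (punchIn x) σ)
distinct-punchIn⁺ x σ d k l e =
  d k l (punchIn-injective x _ _ (trans (sym (lookup-punchIn x σ k)) (trans e (lookup-punchIn x σ l))))

avoids-punchIn : ∀ {n m} (x : Fin (suc n)) (σ : Vec (Fin n) m) → Avoids x (map (punchIn x) σ)
avoids-punchIn x σ p e = punchInᵢ≢i x (lookup σ p) (trans (sym (lookup-punchIn x σ p)) e)

-- The vectors over Fin (suc m) that avoid x are exactly the punchIn x-images of the vectors over Fin m.
count-avoids : ∀ {m} k (x : Fin (suc m)) {Q : Pred (Vec (Fin (suc m)) k) 0ℓ} (Q? : Decidable Q) →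
               count (λ r → avoids? x r ×-dec Q? r) (allVecs (suc m) k) ≡ count (Q? ∘ map (punchIn x)) (allVecs m k)
count-avoids {m} zero x Q? with Q? []
... | yes _ = refl
... | no _  = refl
count-avoids {m} (suc k) x Q? = begin
  count R? (allVecs (suc m) (suc k))
    ≡⟨ count-allVecs-suc R? ⟩
  sum g
    ≡⟨ sum-remove {i = x} g ⟩
  g x + sum (g ∘ punchIn x)
    ≡⟨ cong (_+ sum (g ∘ punchIn x)) (count-none _ (λ r h → proj₁ h fz refl) (allVecs (suc m) k)) ⟩
  sum (g ∘ punchIn x)
    ≡⟨ sum-cong-≗ slice ⟩
  sum (λ z → count (Q? ∘ map (punchIn x) ∘ (z ∷_)) (allVecs m k))
    ≡⟨ count-allVecs-suc (Q? ∘ map (punchIn x)) ⟨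
  count (Q? ∘ map (punchIn x)) (allVecs m (suc k)) ∎
  where
  open ≡-Reasoning
  R? = λ r → avoids? x r ×-dec Q? r
  g : Fin (suc m) → ℕ
  g y = count (R? ∘ (y ∷_)) (allVecs (suc m) k)
  slice : ∀ z → g (punchIn x z) ≡ count (Q? ∘ map (punchIn x) ∘ (z ∷_)) (allVecs m k)
  slice z = trans
    (count-≐ _ (λ r → avoids? x r ×-dec Q? (punchIn x z ∷ r))
      ((λ (x∉ , q) → (x∉ ∘ fs) , q) ,
       (λ (x∉ , q) → (λ { fz → punchInᵢ≢i x z ; (fs p) → x∉ p }) , q))
      (allVecs (suc m) k))
    (count-avoids k x (Q? ∘ (punchIn x z ∷_)))

extend : ∀ {m} → Fin (suc m) → Tuple m → Tuple (suc m)
extend x σ = x ∷ map (punchIn x) σ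

extend-isPerm : ∀ {m} (x : Fin (suc m)) (σ : Tuple m) → IsPerm σ → IsPerm (extend x σ)
extend-isPerm x σ d = distinct-∷⁺ (avoids-punchIn x σ , distinct-punchIn⁺ x σ d)

card-by-first-entry : ∀ {m} {P : Pred (Tuple (suc m)) 0ℓ} (P? : Decidable P) →
                      card P? ≡ sum (λ x → card (P? ∘ extend x))
card-by-first-entry {m} P? = begin
  count R? (allVecs (suc m) (suc m))
    ≡⟨ count-allVecs-suc R? ⟩
  sum (λ x → count (R? ∘ (x ∷_)) (allVecs (suc m) m))
    ≡⟨ sum-cong-≗ first-entry ⟩
  sum (λ x → card (P? ∘ extend x)) ∎
  where
  open ≡-Reasoning
  R? = λ a → isPerm? a ×-dec P? a
  first-entry : ∀ x → count (R? ∘ (x ∷_)) (allVecs (suc m) m) ≡ card (P? ∘ extend x)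
  first-entry x = begin
    count (R? ∘ (x ∷_)) (allVecs (suc m) m)
      ≡⟨ count-≐ _ (λ r → avoids? x r ×-dec (distinct? r ×-dec P? (x ∷ r)))
           ((λ (d , p) → let (x∉r , dr) = distinct-∷⁻ d in x∉r , dr , p) ,
            (λ (x∉r , dr , p) → distinct-∷⁺ (x∉r , dr) , p))
           (allVecs (suc m) m) ⟩
    count (λ r → avoids? x r ×-dec (distinct? r ×-dec P? (x ∷ r))) (allVecs (suc m) m)
      ≡⟨ count-avoids m x (λ r → distinct? r ×-dec P? (x ∷ r)) ⟩
    count (λ σ → distinct? (map (punchIn x) σ) ×-dec P? (extend x σ)) (allVecs m m)
      ≡⟨ count-≐ _ _
           ((λ {σ} (d , p) → distinct-punchIn⁻ x σ d , p) , (λ {σ} (d , p) → distinct-punchIn⁺ x σ d , p))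
           (allVecs m m) ⟩
    card (P? ∘ extend x) ∎

transpose-at-i : ∀ {n} (i j : Fin n) → transpose i j i ≡ j
transpose-at-i i j with i ≟ i
... | yes _ = refl
... | no i≢i = ⊥-elim (i≢i refl)

transpose-at-j : ∀ {n} (i j : Fin n) → transpose i j j ≡ i
transpose-at-j i j with j ≟ i
... | yes j≡i = j≡i
... | no _ with j ≟ j
...   | yes _ = refl
...   | no j≢j = ⊥-elim (j≢j refl)

transpose-fixes : ∀ {n} (i j k : Fin n) → k ≢ i → k ≢ j → transpose i j k ≡ k
transpose-fixes i j k k≢i k≢j with k ≟ i
... | yes k≡i = ⊥-elim (k≢i k≡i)
... | no _ with k ≟ j
...   | yes k≡j = ⊥-elim (k≢j k≡j)
...   | no _ = refl

transpose-punchIn : ∀ {n} (x : Fin (suc n)) (i j z : Fin n) →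
                    transpose (punchIn x i) (punchIn x j) (punchIn x z) ≡ punchIn x (transpose i j z)
transpose-punchIn x i j z = by-cases (z ≟ i) (z ≟ j)
  where
  by-cases : Dec (z ≡ i) → Dec (z ≡ j) →
             transpose (punchIn x i) (punchIn x j) (punchIn x z) ≡ punchIn x (transpose i j z)
  by-cases (yes refl) _ = trans (transpose-at-i (punchIn x i) (punchIn x j)) (cong (punchIn x) (sym (transpose-at-i i j)))
  by-cases (no _) (yes refl) = trans (transpose-at-j (punchIn x i) (punchIn x j)) (cong (punchIn x) (sym (transpose-at-j i j)))
  by-cases (no z≢i) (no z≢j) =
    trans (transpose-fixes _ _ _ (z≢i ∘ punchIn-injective x z i) (z≢j ∘ punchIn-injective x z j))
          (cong (punchIn x) (sym (transpose-fixes i j z z≢i z≢j)))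

swapEntries-extend : ∀ {m} (x : Fin (suc m)) (i j : Fin m) (σ : Tuple m) →
                     swapEntries (punchIn x i) (punchIn x j) (extend x σ) ≡ extend x (swapEntries i j σ)
swapEntries-extend x i j σ = cong₂ _∷_
  (transpose-fixes _ _ x (punchInᵢ≢i x i ∘ sym) (punchInᵢ≢i x j ∘ sym))
  (trans (sym (map-∘ _ _ σ)) (trans (map-cong (transpose-punchIn x i j) σ) (map-∘ _ _ σ)))

extend-inversion : ∀ {m} (x : Fin (suc m)) {i j : Fin m} (σ : Tuple m) →
                   IsInversion σ i j → IsInversion (extend x σ) (punchIn x i) (punchIn x j)
extend-inversion x {i} {j} σ (i<j , later) =
  ≤∧≢⇒< (punchIn-mono-≤ x i j (<⇒≤ i<j)) (<⇒≢ i<j ∘ punchIn-injective x i j) , later′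
  where
  later′ : ∀ p q → lookup (extend x σ) p ≡ punchIn x i → lookup (extend x σ) q ≡ punchIn x j → q Fin.< p
  later′ fz     _      e _  = ⊥-elim (punchInᵢ≢i x i (sym e))
  later′ (fs p) fz     _ e′ = ⊥-elim (punchInᵢ≢i x j (sym e′))
  later′ (fs p) (fs q) e e′ = s≤s (later p q
    (punchIn-injective x _ i (trans (sym (lookup-punchIn x σ p)) e))
    (punchIn-injective x _ j (trans (sym (lookup-punchIn x σ q)) e′)))

Slice : ∀ {m} → Pred (Tuple (suc m)) 0ℓ → Fin (suc m) → Pred (Tuple m) 0ℓ
Slice A x = A ∘ extend x

slice-strongUpSet : ∀ {m} {A : Pred (Tuple (suc m)) 0ℓ} (x : Fin (suc m)) → StrongUpSet A → StrongUpSet (Slice A x)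
slice-strongUpSet {A = A} x up σ σ-perm σ∈A i j inv =
  subst A (swapEntries-extend x i j σ)
    (up (extend x σ) (extend-isPerm x σ σ-perm) σ∈A (punchIn x i) (punchIn x j) (extend-inversion x σ inv))

punchIn-suc-self : ∀ {m} (i : Fin m) → punchIn (fs i) i ≡ inject₁ i
punchIn-suc-self fz     = refl
punchIn-suc-self (fs i) = cong fs (punchIn-suc-self i)

punchIn-inject₁-self : ∀ {m} (i : Fin m) → punchIn (inject₁ i) i ≡ fs i
punchIn-inject₁-self fz     = refl
punchIn-inject₁-self (fs i) = cong fs (punchIn-inject₁-self i)

punchIn-suc-inject₁ : ∀ {m} (i z : Fin m) → z ≢ i → punchIn (fs i) z ≡ punchIn (inject₁ i) z
punchIn-suc-inject₁ fz     fz     z≢i = ⊥-elim (z≢i refl)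
punchIn-suc-inject₁ fz     (fs z) _   = refl
punchIn-suc-inject₁ (fs i) fz     _   = refl
punchIn-suc-inject₁ (fs i) (fs z) z≢i = cong fs (punchIn-suc-inject₁ i z (z≢i ∘ cong fs))

transpose-adjacent-punchIn : ∀ {m} (i z : Fin m) →
                             transpose (inject₁ i) (fs i) (punchIn (fs i) z) ≡ punchIn (inject₁ i) z
transpose-adjacent-punchIn i z with z ≟ i
... | yes refl = begin
  transpose (inject₁ z) (fs z) (punchIn (fs z) z) ≡⟨ cong (transpose (inject₁ z) (fs z)) (punchIn-suc-self z) ⟩
  transpose (inject₁ z) (fs z) (inject₁ z)        ≡⟨ transpose-at-i (inject₁ z) (fs z) ⟩
  fs z                                            ≡⟨ punchIn-inject₁-self z ⟨
  punchIn (inject₁ z) z                           ∎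
  where open ≡-Reasoning
... | no z≢i = trans
  (transpose-fixes _ _ _ (punchInᵢ≢i (inject₁ i) z ∘ trans (sym (punchIn-suc-inject₁ i z z≢i))) (punchInᵢ≢i (fs i) z))
  (punchIn-suc-inject₁ i z z≢i)

slice-antitone : ∀ {m} {A : Pred (Tuple (suc m)) 0ℓ} → StrongUpSet A → (i : Fin m) (σ : Tuple m) →
                 IsPerm σ → Slice A (fs i) σ → Slice A (inject₁ i) σ
slice-antitone {A = A} up i σ σ-perm σ∈A =
  subst A swapped (up (extend (fs i) σ) (extend-isPerm (fs i) σ σ-perm) σ∈A (inject₁ i) (fs i) inversion)
  where
  swapped : swapEntries (inject₁ i) (fs i) (extend (fs i) σ) ≡ extend (inject₁ i) σ
  swapped = cong₂ _∷_ (transpose-at-j (inject₁ i) (fs i))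
                      (trans (sym (map-∘ _ _ σ)) (map-cong (transpose-adjacent-punchIn i) σ))
  inversion : IsInversion (extend (fs i) σ) (inject₁ i) (fs i)
  inversion = s≤s (≤-reflexive (toℕ-inject₁ i)) , later
    where
    later : ∀ p q → lookup (extend (fs i) σ) p ≡ inject₁ i → lookup (extend (fs i) σ) q ≡ fs i → q Fin.< p
    later fz     _      e _  = ⊥-elim (inject₁≢suc i (sym e))
      where
      inject₁≢suc : ∀ {m} (i : Fin m) → inject₁ i ≢ fs i
      inject₁≢suc (fs i) e = inject₁≢suc i (suc-injective e)
    later (fs p) fz     _ _  = s≤s z≤n
    later (fs p) (fs q) _ e′ = ⊥-elim (avoids-punchIn (fs i) σ q e′)

card-slice-nonincreasing : ∀ {m} {A : Pred (Tuple (suc m)) 0ℓ} (A? : Decidable A) → StrongUpSet A →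
                           Nonincreasing (λ x → card (A? ∘ extend x))
card-slice-nonincreasing {m} A? up i =
  count-mono _ _ (λ {σ} (σ-perm , σ∈A) → σ-perm , slice-antitone up i σ σ-perm σ∈A) (allTuples m)

uniform-positively-associated : ∀ n (A B : Pred (Tuple n) 0ℓ) (A? : Decidable A) (B? : Decidable B) →
                                StrongUpSet A → StrongUpSet B → card A? * card B? ≤ n ! * card (∩? A? B?)
uniform-positively-associated zero A B A? B? _ _ with A? [] | B? []
... | yes _ | yes _ = ≤-refl
... | yes _ | no _  = z≤n
... | no _  | _     = z≤n
uniform-positively-associated (suc m) A B A? B? A-up B-up = begin
  card A? * card B?                 ≡⟨ cong₂ _*_ (card-by-first-entry A?) (card-by-first-entry B?) ⟩
  sum a * sum b                     ≤⟨ chebyshev m a b (card-slice-nonincreasing A? A-up) (card-slice-nonincreasing B? B-up) ⟩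
  suc m * sum (λ x → a x * b x)     ≤⟨ *-monoʳ-≤ (suc m) (sum-mono-≤ slices) ⟩
  suc m * sum (λ x → m ! * c x)     ≡⟨ cong (suc m *_) (*-distribˡ-sum (m !) c) ⟨
  suc m * (m ! * sum c)             ≡⟨ *-assoc (suc m) (m !) (sum c) ⟨
  suc m ! * sum c                   ≡⟨ cong (suc m ! *_) (card-by-first-entry (∩? A? B?)) ⟨
  suc m ! * card (∩? A? B?)         ∎
  where
  open ≤-Reasoning
  a b c : Fin (suc m) → ℕ
  a x = card (A? ∘ extend x)
  b x = card (B? ∘ extend x)
  c x = card (∩? (A? ∘ extend x) (B? ∘ extend x))
  slices : ∀ x → a x * b x ≤ m ! * c x
  slices x = uniform-positively-associated m (Slice A x) (Slice B x) (A? ∘ extend x) (B? ∘ extend x)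
               (slice-strongUpSet x A-up) (slice-strongUpSet x B-up)

theorem1 : (n : ℕ) → 1 ≤ n →
    (A B : Pred (Tuple n) 0ℓ) (A? : Decidable A) (B? : Decidable B) →
    StrongUpSet A → StrongUpSet B →
    card A? * card B? ≤ n ! * card (∩? A? B?)
theorem1 n _ = uniform-positively-associated n
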